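{- Let $\Gamma$ be a finite, simple, connected graph in which every vertex has odd valency, and let $C$ be a semiregular cyclic group of automorphisms of $\Gamma$. If $C$ has an odd number of orbits on the vertices of $\Gamma$, then $|C|$ is even and the unique involution of $C$ reverses some edge of $\Gamma$ (that is, it swaps the two endpoints of some edge).
   Context: A permutation group is semiregular if its only element fixing a point is the identity. -}

module Defs where

open import Data.Nat using (ℕ; zero; suc; _≤_; _<_; _≤?_; _*_)
open import Data.Bool using (Bool; true; false; if_then_else_)
open import Data.Fin using (Fin; toℕ)
open import Data.Fin.Properties using (all?)
open import Data.Fin.Permutation using (Permutation′; _⟨$⟩ʳ_)
open import Data.List using (List; length; filter; map; allFin)
open import Data.Nat.ListAction using (sum)
open import Relation.Nullary using (Dec)
open import Data.Product using (Σ; ∃; _×_; _,_)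
open import Relation.Binary.PropositionalEquality using (_≡_; _≢_)

record Graph (n : ℕ) : Set where
  field
    adj       : Fin n → Fin n → Bool
    irreflexive : ∀ v → adj v v ≡ false
    symmetric   : ∀ u v → adj u v ≡ adj v u

open Graph public

Even : ℕ → Set
Even m = ∃ λ k → m ≡ 2 * k

Odd : ℕ → Set
Odd m = ∃ λ k → m ≡ suc (2 * k)

degree : ∀ {n} → Graph n → Fin n → ℕ
degree {n} Γ v = sum (map (λ u → if adj Γ v u then 1 else 0) (allFin n))

data Walk {n : ℕ} (Γ : Graph n) : Fin n → Fin n → Set where
  here : ∀ {v} → Walk Γ v v
  step : ∀ {u v w} → adj Γ u v ≡ true → Walk Γ v w → Walk Γ u w

Connected : ∀ {n} → Graph n → Set
Connected {n} Γ = ∀ (u v : Fin n) → Walk Γ u v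

IsAutomorphism : ∀ {n} → Graph n → Permutation′ n → Set
IsAutomorphism Γ g = ∀ u v → adj Γ (g ⟨$⟩ʳ u) (g ⟨$⟩ʳ v) ≡ adj Γ u v

pow : ∀ {n} → Permutation′ n → ℕ → Fin n → Fin n
pow g zero    x = x
pow g (suc k) x = g ⟨$⟩ʳ pow g k x

-- m is the order of g, i.e. m = |C| for the cyclic group C = ⟨g⟩
IsOrder : ∀ {n} → Permutation′ n → ℕ → Set
IsOrder {n} g m =
  (1 ≤ m) × (∀ x → pow g m x ≡ x) ×
  (∀ k → 1 ≤ k → k < m → Σ (Fin n) λ x → pow g k x ≢ x)

Semiregular : ∀ {n} → Permutation′ n → Set
Semiregular g = ∀ k x → pow g k x ≡ x → ∀ y → pow g k y ≡ y

-- v is the representative (the least vertex) of its C-orbit {g^k v | k < m}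
IsOrbitRep : ∀ {n} → Permutation′ n → (m : ℕ) → Fin n → Set
IsOrbitRep g m v = ∀ (k : Fin m) → toℕ v ≤ toℕ (pow g (toℕ k) v)

isOrbitRep? : ∀ {n} (g : Permutation′ n) (m : ℕ) (v : Fin n) →
              Dec (IsOrbitRep g m v)
isOrbitRep? g m v = all? (λ k → toℕ v ≤? toℕ (pow g (toℕ k) v))

numOrbits : ∀ {n} → Permutation′ n → ℕ → ℕ
numOrbits {n} g m = length (filter (isOrbitRep? g m) (allFin n))

IsInvolution : ∀ {n} → (Fin n → Fin n) → Set
IsInvolution {n} σ = (Σ (Fin n) λ x → σ x ≢ x) × (∀ x → σ (σ x) ≡ x)

ReversesEdge : ∀ {n} → Graph n → (Fin n → Fin n) → Set
ReversesEdge {n} Γ σ =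
  Σ (Fin n) λ u → Σ (Fin n) λ v → (adj Γ u v ≡ true) × (σ u ≡ v) × (σ v ≡ u)

module Submission where

-- Let R be the set of orbit representatives (the least vertex of
-- each orbit of C = ⟨g⟩) and consider the arcs (r , v) of Γ leaving a
-- representative r.  Since every valency is odd, the number of such arcs has
-- the parity of |R|, the number of orbits, which is odd.  Reversing an arc
-- and translating it back to a representative, (r , v) ↦ (rep v , g^j r)
-- where g^j v = rep v, is an involution of this arc set (semiregularity makes
-- the translating element unique).  An involution of a finite set of odd size
-- has a fixed point; a fixed arc (r , v) gives an element g^j swapping the
-- adjacent vertices r and v.  Then g^(2j) fixes r, hence is the identity, so
-- |C| = 2·(j mod |C|) is even, and every involution g^k of C coincides with g^j.

open import Defs
open import Data.Nat using (ℕ; zero; suc; _+_; _*_; _∸_; _<_; _≤_; NonZero; >-nonZero)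
open import Data.Nat.Base using (parity)
open import Data.Nat.Properties
  using (≤-totalOrder; +-0-commutativeMonoid; +-identityʳ; +-assoc; +-mono-<; +-monoʳ-≤; m≤m+n;
         <⇒≱; <-≤-trans; n≢0⇒n>0; m∸n+n≡m; <⇒≤; ≤-antisym; *-cancelˡ-≡)
  renaming (_≟_ to _≟ℕ_)
open import Data.Nat.DivMod using (_%_; _/_; m%n<n; m≡m%n+[m/n]*n)
open import Data.Nat.Divisibility using (_∣_; divides; m%n≡0⇒n∣m)
open import Data.Nat.ListAction using () renaming (sum to sumList)
open import Data.Parity.Base as ℙ using (0ℙ; 1ℙ)
open import Data.Parity.Properties using (+-homo-+; *-homo-*)
open import Data.Bool using (Bool; true; false; _∧_; if_then_else_)
open import Data.Bool.Properties using () renaming (_≟_ to _≟ᵇ_)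
open import Data.Fin using (Fin; zero; suc; toℕ; fromℕ<; combine; remQuot; _↑ˡ_; _↑ʳ_)
open import Data.Fin.Properties
  using (_≟_; _<?_; <-cmp; any?; toℕ-fromℕ<; toℕ-injective; remQuot-combine; combine-remQuot)
open import Data.Fin.Permutation using (Permutation′; permutation; _⟨$⟩ʳ_)
open import Data.List using (List; []; _∷_; length; filter; map; allFin; tabulate; upTo)
open import Data.List.Properties using (map-tabulate)
open import Data.List.Relation.Unary.All using (lookup)
open import Data.List.Membership.Propositional.Properties using (∈-upTo⁺)
open import Data.List.Extrema ≤-totalOrder using (argmin; f[argmin]≤f[xs])
open import Algebra.Properties.CommutativeMonoid.Sum +-0-commutativeMonoid
  using (sum-syntax; sum-cong-≗; sum-replicate-zero; ∑-distrib-+; ∑-permute)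
open import Data.Product using (Σ; ∃; _×_; _,_; proj₁; proj₂; uncurry)
open import Data.Sum using (_⊎_; inj₁; inj₂)
open import Relation.Binary using (tri<; tri≈; tri>)
open import Relation.Nullary using (Dec; yes; no; does; contradiction)
open import Relation.Nullary.Decidable using (_×-dec_; dec-true; dec-false)
open import Relation.Binary.PropositionalEquality
open import Function using (_∘_; id)
open ≡-Reasoning

𝟙 : Bool → ℕ
𝟙 b = if b then 1 else 0

count : ∀ {N} → (Fin N → Bool) → ℕ
count {N} χ = ∑[ k < N ] 𝟙 (χ k)

sumList-allFin : ∀ N (h : Fin N → ℕ) → sumList (map h (allFin N)) ≡ ∑[ i < N ] h i
sumList-allFin N h = trans (cong sumList (map-tabulate id h)) (sumList-tabulate N h)
  where
  sumList-tabulate : ∀ N (h : Fin N → ℕ) → sumList (tabulate h) ≡ ∑[ i < N ] h i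
  sumList-tabulate zero    h = refl
  sumList-tabulate (suc N) h = cong (h zero +_) (sumList-tabulate N (h ∘ suc))

length-filter : ∀ {A : Set} {P : A → Set} (P? : ∀ x → Dec (P x)) (xs : List A) →
                length (filter P? xs) ≡ sumList (map (𝟙 ∘ does ∘ P?) xs)
length-filter P? [] = refl
length-filter P? (x ∷ xs) with does (P? x)
... | true  = cong suc (length-filter P? xs)
... | false = length-filter P? xs

∑-split : ∀ a b (h : Fin (a + b) → ℕ) →
          ∑[ k < a + b ] h k ≡ ∑[ i < a ] h (i ↑ˡ b) + ∑[ j < b ] h (a ↑ʳ j)
∑-split zero    b h = refl
∑-split (suc a) b h =
  trans (cong (h zero +_) (∑-split a b (h ∘ suc))) (sym (+-assoc (h zero) _ _))

∑-combine : ∀ a b (h : Fin (a * b) → ℕ) →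
            ∑[ k < a * b ] h k ≡ ∑[ i < a ] ∑[ j < b ] h (combine i j)
∑-combine zero    b h = refl
∑-combine (suc a) b h =
  trans (∑-split b (a * b) h)
        (cong (∑[ j < b ] h (j ↑ˡ a * b) +_) (∑-combine a b (λ k → h (b ↑ʳ k))))

does-true : ∀ {A : Set} (a? : Dec A) → does a? ≡ true → A
does-true (yes a) _ = a

∧-true : ∀ {a b} → a ∧ b ≡ true → a ≡ true × b ≡ true
∧-true {true} {true} _ = refl , refl

parity-even : ∀ {d} → Even d → parity d ≡ 0ℙ
parity-even (k , refl) = *-homo-* 2 k

parity-odd : ∀ {d} → Odd d → parity d ≡ 1ℙ
parity-odd (k , refl) = trans (+-homo-+ 1 (2 * k)) (cong (1ℙ ℙ.+_) (parity-even (k , refl)))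

parity-∑-cong : ∀ {N} {h h′ : Fin N → ℕ} → (∀ i → parity (h i) ≡ parity (h′ i)) →
                parity (∑[ i < N ] h i) ≡ parity (∑[ i < N ] h′ i)
parity-∑-cong {zero}          e = refl
parity-∑-cong {suc N} {h} {h′} e = begin
  parity (h zero + ∑[ i < N ] h (suc i))               ≡⟨ +-homo-+ (h zero) _ ⟩
  parity (h zero) ℙ.+ parity (∑[ i < N ] h (suc i))    ≡⟨ cong₂ ℙ._+_ (e zero) (parity-∑-cong (e ∘ suc)) ⟩
  parity (h′ zero) ℙ.+ parity (∑[ i < N ] h′ (suc i))  ≡⟨ +-homo-+ (h′ zero) _ ⟨
  parity (h′ zero + ∑[ i < N ] h′ (suc i))             ∎

exactly-one-smaller : ∀ {N} {x y : Fin N} → x ≢ y →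
                      𝟙 (does (x <? y)) + 𝟙 (does (y <? x)) ≡ 1
exactly-one-smaller {x = x} {y} x≢y with <-cmp x y
... | tri< x<y _ y≮x rewrite dec-true (x <? y) x<y | dec-false (y <? x) y≮x = refl
... | tri≈ _ x≡y _ = contradiction x≡y x≢y
... | tri> x≮y _ y<x rewrite dec-false (x <? y) x≮y | dec-true (y <? x) y<x = refl

-- If f has no fixed point in χ,
-- its orbits on χ are pairs, so |χ| is even; hence if |χ| is odd, f fixes a
-- point of χ.
module InvolutionFixedPoint {N : ℕ} (χ : Fin N → Bool) (f : Fin N → Fin N)
         (closed : ∀ k → χ k ≡ true → χ (f k) ≡ true)
         (involutive : ∀ k → χ k ≡ true → f (f k) ≡ k) where

  f̂ : Fin N → Fin N
  f̂ k = if χ k then f k else k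

  f̂-involutive : ∀ k → f̂ (f̂ k) ≡ k
  f̂-involutive k with χ k in χk
  ... | true  rewrite closed k χk = involutive k χk
  ... | false rewrite χk = refl

  f̂-permutation : Permutation′ N
  f̂-permutation = permutation f̂ f̂ f̂-involutive f̂-involutive

  leads : Fin N → ℕ
  leads k = 𝟙 (χ k ∧ does (k <? f k))

  pairing : (∀ k → χ k ≡ true → f k ≢ k) → ∀ k → 𝟙 (χ k) ≡ leads k + leads (f̂ k)
  pairing free k with χ k in χk
  ... | false rewrite χk = refl
  ... | true  rewrite closed k χk | involutive k χk =
    sym (exactly-one-smaller (λ k≡fk → free k χk (sym k≡fk)))

  fixed-point-free⇒even : (∀ k → χ k ≡ true → f k ≢ k) → Even (count χ)
  fixed-point-free⇒even free = pairs , (begin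
    ∑[ k < N ] 𝟙 (χ k)                          ≡⟨ sum-cong-≗ (pairing free) ⟩
    ∑[ k < N ] (leads k + leads (f̂ k))          ≡⟨ ∑-distrib-+ leads (leads ∘ f̂) ⟩
    pairs + ∑[ k < N ] leads (f̂ k)              ≡⟨ cong (pairs +_) (∑-permute leads f̂-permutation) ⟨
    pairs + pairs                               ≡⟨ cong (pairs +_) (+-identityʳ pairs) ⟨
    2 * pairs                                   ∎)
    where
    pairs : ℕ
    pairs = ∑[ k < N ] leads k

  fixedPoint : parity (count χ) ≡ 1ℙ → ∃ λ k → χ k ≡ true × f k ≡ k
  fixedPoint odd with any? (λ k → (χ k ≟ᵇ true) ×-dec (f k ≟ k))
  ... | yes found = found
  ... | no none =
    contradiction (trans (sym (parity-even (fixed-point-free⇒even free))) odd) λ ()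
    where
    free : ∀ k → χ k ≡ true → f k ≢ k
    free k χk fk≡k = none (k , χk , fk≡k)

pairFixedPoint : ∀ {a b} (χ : Fin a × Fin b → Bool) (f : Fin a × Fin b → Fin a × Fin b) →
                 (∀ p → χ p ≡ true → χ (f p) ≡ true) →
                 (∀ p → χ p ≡ true → f (f p) ≡ p) →
                 parity (∑[ i < a ] ∑[ j < b ] 𝟙 (χ (i , j))) ≡ 1ℙ →
                 ∃ λ p → χ p ≡ true × f p ≡ p
pairFixedPoint {a} {b} χ f closed involutive odd =
  fromCode (InvolutionFixedPoint.fixedPoint χ′ f′ closed′ involutive′ odd′)
  where
  decode : Fin (a * b) → Fin a × Fin b
  decode = remQuot b

  decode-encode : ∀ p → decode (uncurry combine p) ≡ p
  decode-encode (i , j) = remQuot-combine i j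

  χ′ : Fin (a * b) → Bool
  χ′ = χ ∘ decode

  f′ : Fin (a * b) → Fin (a * b)
  f′ = uncurry combine ∘ f ∘ decode

  closed′ : ∀ k → χ′ k ≡ true → χ′ (f′ k) ≡ true
  closed′ k χk rewrite decode-encode (f (decode k)) = closed (decode k) χk

  involutive′ : ∀ k → χ′ k ≡ true → f′ (f′ k) ≡ k
  involutive′ k χk rewrite decode-encode (f (decode k)) | involutive (decode k) χk =
    combine-remQuot {a} b k

  odd′ : parity (count χ′) ≡ 1ℙ
  odd′ = trans (cong parity (trans (∑-combine a b (𝟙 ∘ χ′))
                 (sum-cong-≗ (λ i → sum-cong-≗ (λ j → cong (𝟙 ∘ χ) (remQuot-combine i j))))))
               odd

  fromCode : (∃ λ k → χ′ k ≡ true × f′ k ≡ k) → ∃ λ p → χ p ≡ true × f p ≡ p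
  fromCode (k , χk , f′k≡k) = decode k , χk , (begin
    f (decode k)                             ≡⟨ decode-encode (f (decode k)) ⟨
    decode (uncurry combine (f (decode k)))  ≡⟨ cong decode f′k≡k ⟩
    decode k                                 ∎)

multiple-in-range : ∀ {m d} → m ∣ d → 0 < d → d < m + m → d ≡ m
multiple-in-range (divides zero refl) () _
multiple-in-range (divides 1 d≡m) _ _ = trans d≡m (+-identityʳ _)
multiple-in-range {m} (divides (suc (suc q)) refl) _ d<2m =
  contradiction (+-monoʳ-≤ m (m≤m+n m (q * m))) (<⇒≱ d<2m)

double-injective : ∀ {a b} → a + a ≡ b + b → a ≡ b
double-injective {a} {b} a+a≡b+b = *-cancelˡ-≡ a b 2 (begin
  a + (a + 0)  ≡⟨ cong (a +_) (+-identityʳ a) ⟩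
  a + a        ≡⟨ a+a≡b+b ⟩
  b + b        ≡⟨ cong (b +_) (+-identityʳ b) ⟨
  b + (b + 0)  ∎)

pow-+ : ∀ {n} (g : Permutation′ n) a b x → pow g (a + b) x ≡ pow g a (pow g b x)
pow-+ g zero    b x = refl
pow-+ g (suc a) b x = cong (g ⟨$⟩ʳ_) (pow-+ g a b x)

pow-automorphism : ∀ {n} (Γ : Graph n) (g : Permutation′ n) → IsAutomorphism Γ g →
                   ∀ a u v → adj Γ (pow g a u) (pow g a v) ≡ adj Γ u v
pow-automorphism Γ g aut zero    u v = refl
pow-automorphism Γ g aut (suc a) u v =
  trans (aut (pow g a u) (pow g a v)) (pow-automorphism Γ g aut a u v)

module SemiregularCyclic {n : ℕ} (g : Permutation′ n) (m : ℕ) .{{_ : NonZero m}}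
         (order : IsOrder g m) (semiregular : Semiregular g) where

  pow-m : ∀ x → pow g m x ≡ x
  pow-m = proj₁ (proj₂ order)

  pow-multiple : ∀ q x → pow g (q * m) x ≡ x
  pow-multiple zero    x = refl
  pow-multiple (suc q) x =
    trans (pow-+ g m (q * m) x) (trans (cong (pow g m) (pow-multiple q x)) (pow-m x))

  pow-mod : ∀ a x → pow g a x ≡ pow g (a % m) x
  pow-mod a x = begin
    pow g a x                               ≡⟨ cong (λ e → pow g e x) (m≡m%n+[m/n]*n a m) ⟩
    pow g (a % m + (a / m) * m) x           ≡⟨ pow-+ g (a % m) ((a / m) * m) x ⟩
    pow g (a % m) (pow g ((a / m) * m) x)   ≡⟨ cong (pow g (a % m)) (pow-multiple (a / m) x) ⟩
    pow g (a % m) x                         ∎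

  all-powers : ∀ {P : Fin n → Set} x → (∀ a → a < m → P (pow g a x)) → ∀ a → P (pow g a x)
  all-powers {P} x below a = subst P (sym (pow-mod a x)) (below (a % m) (m%n<n a m))

  pow-inverse : ∀ b x → pow g (m ∸ b % m) (pow g b x) ≡ x
  pow-inverse b x = begin
    pow g (m ∸ b % m) (pow g b x)        ≡⟨ cong (pow g (m ∸ b % m)) (pow-mod b x) ⟩
    pow g (m ∸ b % m) (pow g (b % m) x)  ≡⟨ pow-+ g (m ∸ b % m) (b % m) x ⟨
    pow g (m ∸ b % m + b % m) x          ≡⟨ cong (λ e → pow g e x) (m∸n+n≡m (<⇒≤ (m%n<n b m))) ⟩
    pow g m x                            ≡⟨ pow-m x ⟩
    x                                    ∎

  -- By semiregularity and minimality of m, g^a fixes a point only if m ∣ a.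
  fixes⇒order∣ : ∀ a x → pow g a x ≡ x → m ∣ a
  fixes⇒order∣ a x fixed with a % m ≟ℕ 0
  ... | yes a%m≡0 = m%n≡0⇒n∣m a m a%m≡0
  ... | no  a%m≢0 with proj₂ (proj₂ order) (a % m) (n≢0⇒n>0 a%m≢0) (m%n<n a m)
  ...   | y , moved = contradiction (semiregular (a % m) x (trans (sym (pow-mod a x)) fixed) y) moved

  square-root-of-identity : ∀ a x → pow g (a + a) x ≡ x →
                            (∀ y → pow g a y ≡ y) ⊎ (a % m + a % m ≡ m)
  square-root-of-identity a x fixed with a % m ≟ℕ 0
  ... | yes a%m≡0 = inj₁ λ y → trans (pow-mod a y) (cong (λ e → pow g e y) a%m≡0)
  ... | no  a%m≢0 = inj₂ (multiple-in-range (fixes⇒order∣ (a % m + a % m) x reduced-fixed)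
                       (<-≤-trans (n≢0⇒n>0 a%m≢0) (m≤m+n (a % m) (a % m)))
                       (+-mono-< (m%n<n a m) (m%n<n a m)))
    where
    reduced-fixed : pow g (a % m + a % m) x ≡ x
    reduced-fixed = begin
      pow g (a % m + a % m) x            ≡⟨ pow-+ g (a % m) (a % m) x ⟩
      pow g (a % m) (pow g (a % m) x)    ≡⟨ cong (pow g (a % m)) (pow-mod a x) ⟨
      pow g (a % m) (pow g a x)          ≡⟨ pow-mod a (pow g a x) ⟨
      pow g a (pow g a x)                ≡⟨ pow-+ g a a x ⟨
      pow g (a + a) x                    ≡⟨ fixed ⟩
      x                                  ∎

  -- Orbit representatives.  r is least in its orbit if it is below all of
  -- its images; this is `IsOrbitRep` of Defs, which tests only powers below m.
  IsLeastInOrbit : Fin n → Set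
  IsLeastInOrbit r = ∀ a → toℕ r ≤ toℕ (pow g a r)

  orbitRep⇒least : ∀ r → IsOrbitRep g m r → IsLeastInOrbit r
  orbitRep⇒least r rep = all-powers {P = λ w → toℕ r ≤ toℕ w} r λ a a<m →
    subst (λ e → toℕ r ≤ toℕ (pow g e r)) (toℕ-fromℕ< a<m) (rep (fromℕ< a<m))

  least⇒orbitRep : ∀ r → IsLeastInOrbit r → IsOrbitRep g m r
  least⇒orbitRep r least k = least (toℕ k)

  toRep : Fin n → ℕ
  toRep v = argmin (λ a → toℕ (pow g a v)) 0 (upTo m)

  rep : Fin n → Fin n
  rep v = pow g (toRep v) v

  rep-minimal : ∀ v a → toℕ (rep v) ≤ toℕ (pow g a v)
  rep-minimal v = all-powers {P = λ w → toℕ (rep v) ≤ toℕ w} v λ a a<m →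
    lookup (f[argmin]≤f[xs] {f = λ a → toℕ (pow g a v)} 0 (upTo m)) (∈-upTo⁺ a<m)

  rep-least : ∀ v → IsLeastInOrbit (rep v)
  rep-least v a = subst (λ w → toℕ (rep v) ≤ toℕ w) (pow-+ g a (toRep v) v)
                        (rep-minimal v (a + toRep v))

  rep-unique : ∀ r b → IsLeastInOrbit r → rep (pow g b r) ≡ r
  rep-unique r b least = toℕ-injective (≤-antisym rep≤r r≤rep)
    where
    w : Fin n
    w = pow g b r
    rep≤r : toℕ (rep w) ≤ toℕ r
    rep≤r = subst (λ z → toℕ (rep w) ≤ toℕ z) (pow-inverse b r) (rep-minimal w (m ∸ b % m))
    r≤rep : toℕ r ≤ toℕ (rep w)
    r≤rep = subst (λ z → toℕ r ≤ toℕ z) (pow-+ g (toRep w) b r) (least (toRep w + b))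

  -- Involutions of C.  An element swapping two points is an involution; an
  -- involution g^a has a ≡ m/2 modulo m, so m is even and C has at most one
  -- involution.
  swap⇒involution : ∀ j r v → r ≢ v → pow g j r ≡ v → pow g j v ≡ r →
                    IsInvolution (pow g j)
  swap⇒involution j r v r≢v jr≡v jv≡r =
    (r , λ jr≡r → r≢v (trans (sym jr≡r) jr≡v)) ,
    λ y → trans (sym (pow-+ g j j y)) (semiregular (j + j) r jjr≡r y)
    where
    jjr≡r : pow g (j + j) r ≡ r
    jjr≡r = trans (pow-+ g j j r) (trans (cong (pow g j) jr≡v) jv≡r)

  involution⇒half : ∀ a → IsInvolution (pow g a) → a % m + a % m ≡ m
  involution⇒half a ((x , moved) , square)
    with square-root-of-identity a x (trans (pow-+ g a a x) (square x))
  ... | inj₁ identity = contradiction (identity x) moved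
  ... | inj₂ half     = half

  involution⇒even-order : ∀ a → IsInvolution (pow g a) → Even m
  involution⇒even-order a inv =
    a % m , trans (sym (involution⇒half a inv)) (cong (a % m +_) (sym (+-identityʳ (a % m))))

  involution-unique : ∀ j k → IsInvolution (pow g j) → IsInvolution (pow g k) →
                      ∀ y → pow g k y ≡ pow g j y
  involution-unique j k inv-j inv-k y = begin
    pow g k y        ≡⟨ pow-mod k y ⟩
    pow g (k % m) y  ≡⟨ cong (λ e → pow g e y) k%m≡j%m ⟩
    pow g (j % m) y  ≡⟨ pow-mod j y ⟨
    pow g j y        ∎
    where
    k%m≡j%m : k % m ≡ j % m
    k%m≡j%m = double-injective
      (trans (involution⇒half k inv-k) (sym (involution⇒half j inv-j)))

  module ArcReversal (Γ : Graph n) (automorphism : IsAutomorphism Γ g) where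

    isRep : Fin n → Bool
    isRep r = does (isOrbitRep? g m r)

    isRep⇒least : ∀ r → isRep r ≡ true → IsLeastInOrbit r
    isRep⇒least r isRep-r = orbitRep⇒least r (does-true (isOrbitRep? g m r) isRep-r)

    rep-isRep : ∀ v → isRep (rep v) ≡ true
    rep-isRep v = dec-true (isOrbitRep? g m (rep v)) (least⇒orbitRep (rep v) (rep-least v))

    isArc : Fin n × Fin n → Bool
    isArc (r , v) = isRep r ∧ adj Γ r v

    reverse : Fin n × Fin n → Fin n × Fin n
    reverse (r , v) = rep v , pow g (toRep v) r

    reverse-closed : ∀ p → isArc p ≡ true → isArc (reverse p) ≡ true
    reverse-closed (r , v) arc
      rewrite rep-isRep v | pow-automorphism Γ g automorphism (toRep v) v r | symmetric Γ v r =
      proj₂ (∧-true arc)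

    -- The new tail rep v lies in the orbit of v, the new head w in that of the
    -- representative r; so rep w = r, and the element g^(toRep w + toRep v)
    -- fixes r, hence (semiregularity) also v.
    reverse-involutive : ∀ p → isArc p ≡ true → reverse (reverse p) ≡ p
    reverse-involutive (r , v) arc = cong₂ _,_ rep-w≡r (begin
      pow g (toRep w) (pow g j v)  ≡⟨ pow-+ g (toRep w) j v ⟨
      pow g (toRep w + j) v        ≡⟨ semiregular (toRep w + j) r fixes-r v ⟩
      v                            ∎)
      where
      j : ℕ
      j = toRep v
      w : Fin n
      w = pow g j r
      rep-w≡r : rep w ≡ r
      rep-w≡r = rep-unique r j (isRep⇒least r (proj₁ (∧-true arc)))
      fixes-r : pow g (toRep w + j) r ≡ r
      fixes-r = trans (pow-+ g (toRep w) j r) rep-w≡r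

    -- Counting arcs row by row: a representative contributes its odd
    -- valency, any other vertex nothing; so the number of arcs has the parity
    -- of the number of orbits.
    arcs-parity : (∀ v → Odd (degree Γ v)) →
                  parity (∑[ r < n ] ∑[ v < n ] 𝟙 (isArc (r , v))) ≡ parity (numOrbits g m)
    arcs-parity odd-degree = begin
      parity (∑[ r < n ] ∑[ v < n ] 𝟙 (isArc (r , v)))  ≡⟨ parity-∑-cong row-parity ⟩
      parity (∑[ r < n ] 𝟙 (isRep r))                    ≡⟨ cong parity orbits ⟨
      parity (numOrbits g m)                             ∎
      where
      row-parity : ∀ r → parity (∑[ v < n ] 𝟙 (isArc (r , v))) ≡ parity (𝟙 (isRep r))
      row-parity r with isRep r
      ... | true  = trans (cong parity (sym (sumList-allFin n (𝟙 ∘ adj Γ r))))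
                          (parity-odd (odd-degree r))
      ... | false = cong parity (sum-replicate-zero n)
      orbits : numOrbits g m ≡ ∑[ r < n ] 𝟙 (isRep r)
      orbits = trans (length-filter (isOrbitRep? g m) (allFin n)) (sumList-allFin n (𝟙 ∘ isRep))

    -- An element of C reversing an edge is an involution (Γ has no loops).
    reversal⇒involution : ∀ j → ReversesEdge Γ (pow g j) → IsInvolution (pow g j)
    reversal⇒involution j (r , v , edge , jr≡v , jv≡r) = swap⇒involution j r v r≢v jr≡v jv≡r
      where
      r≢v : r ≢ v
      r≢v r≡v = contradiction
        (trans (sym edge) (subst (λ w → adj Γ r w ≡ false) r≡v (irreflexive Γ r))) λ ()

    edge-reversal : (∀ v → Odd (degree Γ v)) → Odd (numOrbits g m) →
                    Σ ℕ λ j → ReversesEdge Γ (pow g j)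
    edge-reversal odd-degree odd-orbits =
      fromFixedArc (pairFixedPoint isArc reverse reverse-closed reverse-involutive odd-arcs)
      where
      odd-arcs : parity (∑[ r < n ] ∑[ v < n ] 𝟙 (isArc (r , v))) ≡ 1ℙ
      odd-arcs = trans (arcs-parity odd-degree) (parity-odd odd-orbits)

      fromFixedArc : (∃ λ p → isArc p ≡ true × reverse p ≡ p) →
                     Σ ℕ λ j → ReversesEdge Γ (pow g j)
      fromFixedArc ((r , v) , arc , fixed) =
        toRep v , r , v , proj₂ (∧-true arc) , cong proj₂ fixed , cong proj₁ fixed

reversesEdge-cong : ∀ {n} (Γ : Graph n) {σ τ : Fin n → Fin n} → (∀ y → σ y ≡ τ y) →
                    ReversesEdge Γ τ → ReversesEdge Γ σ
reversesEdge-cong Γ σ≗τ (r , v , edge , τr≡v , τv≡r) =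
  r , v , edge , trans (σ≗τ r) τr≡v , trans (σ≗τ v) τv≡r

lemma4p3 : (n : ℕ) (Γ : Graph n) → Connected Γ → (∀ (v : Fin n) → Odd (degree Γ v)) →
           (g : Permutation′ n) → IsAutomorphism Γ g → Semiregular g →
           (m : ℕ) → IsOrder g m → Odd (numOrbits g m) →
           Even m × (∀ k → IsInvolution (pow g k) → ReversesEdge Γ (pow g k))
lemma4p3 n Γ _ odd-degree g automorphism semiregular m order odd-orbits =
  conclude (edge-reversal odd-degree odd-orbits)
  where
  open SemiregularCyclic g m {{>-nonZero (proj₁ order)}} order semiregular
  open ArcReversal Γ automorphism

  -- The reversing element g^j is an involution, hence the unique one.
  conclude : Σ ℕ (λ j → ReversesEdge Γ (pow g j)) →
             Even m × (∀ k → IsInvolution (pow g k) → ReversesEdge Γ (pow g k))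
  conclude (j , reversal) =
    involution⇒even-order j inv-j ,
    λ k inv-k → reversesEdge-cong Γ (involution-unique j k inv-j inv-k) reversal
    where
    inv-j : IsInvolution (pow g j)
    inv-j = reversal⇒involution j reversal
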